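{- Let $k$ be a positive integer and let $G$ be a connected graph on $n$ vertices with minimum degree $\delta$ and $\operatorname{diam}(G)\ge k+1$. Let $S\subseteq V(G)$ be a $k$-independent set in $G$. Let $i$ be an integer with $3\le i\le \frac{k}{2}-1$. Then $$|N^{i-1}(S)|+|N^i(S)|+|N^{i+1}(S)|\ge 3|S|$$ (for any value of $\delta$), and if $\delta\ge 2$ then $$|N^{i-1}(S)|+|N^i(S)|+|N^{i+1}(S)|\ge (\delta+1)|S|.$$
   Context: All graphs are finite, simple and undirected. For vertices $u,v$, $d(u,v)$ is the length of a shortest $u$–$v$ path. For a nonnegative integer $k$, a $k$-independent set in $G$ is a set $S\subseteq V(G)$ such that any two distinct vertices of $S$ are at distance greater than $k$. For $S\subseteq V(G)$, $N(S)$ denotes the neighborhood of $S$; set $N^0(S)=S$, $N^1(S)=N(S)$, and for $j\ge 2$, $N^j(S)=N(N^{j-1}(S))\setminus (N^{j-2}(S)\cup N^{j-1}(S))$. For a single vertex $v$, $N^j(v)=N^j(\{v\})$. -}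

module Defs where

open import Data.Nat using (ℕ; zero; suc; _+_; _*_; _≤_; _<_)
open import Data.Fin using (Fin)
open import Data.Bool using (Bool; true; false; _∧_)
open import Data.List using (allFin)
open import Data.Bool.ListAction using (any)
open import Data.Vec using (tabulate; lookup)
open import Data.Fin.Subset using (Subset; _∪_; _─_; _∈_; ∣_∣)
open import Data.Product using (_×_; _,_; proj₁; Σ; ∃)
open import Relation.Binary.PropositionalEquality using (_≡_; _≢_)
open import Relation.Nullary using (¬_)

record Graph (n : ℕ) : Set where
  field
    adj    : Fin n → Fin n → Bool
    sym    : ∀ u v → adj u v ≡ adj v u
    irrefl : ∀ v → adj v v ≡ false

open Graph public

module _ {n : ℕ} (G : Graph n) where

  Adj : Fin n → Fin n → Set
  Adj u v = adj G u v ≡ true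

  data Walk : Fin n → Fin n → ℕ → Set where
    [] : ∀ {v} → Walk v v 0
    _∷_ : ∀ {u w v ℓ} → Adj u w → Walk w v ℓ → Walk u v (suc ℓ)

  Connected : Set
  Connected = ∀ u v → ∃ λ ℓ → Walk u v ℓ

  IsDist : Fin n → Fin n → ℕ → Set
  IsDist u v d = Walk u v d × (∀ ℓ → ℓ < d → ¬ Walk u v ℓ)

  DiamAtLeast : ℕ → Set
  DiamAtLeast m = Σ (Fin n) λ u → Σ (Fin n) λ v → Σ ℕ λ d → IsDist u v d × m ≤ d

  KIndependent : ℕ → Subset n → Set
  KIndependent k S = ∀ u v → u ∈ S → v ∈ S → u ≢ v → ∀ d → IsDist u v d → k < d

  degree : Fin n → ℕ
  degree v = ∣ tabulate (adj G v) ∣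

  IsMinDegree : ℕ → Set
  IsMinDegree δ = (∀ v → δ ≤ degree v) × (∃ λ v → degree v ≡ δ)

  N : Subset n → Subset n
  N S = tabulate λ v → any (λ u → lookup S u ∧ adj G u v) (allFin n)

  Npair : Subset n → ℕ → Subset n × Subset n
  Npair S zero = S , N S
  Npair S (suc j) with Npair S j
  ... | a , b = b , (N b ─ (a ∪ b))

  Nʲ : ℕ → Subset n → Subset n
  Nʲ j S = proj₁ (Npair S j)

module Submission where

-- Write i = p + 1 and r = i + 1, so that 2r ≤ k.  Call a
-- vertex x "near" s ∈ S if some walk from s to x has length at most r.  Since
-- distinct members of S are more than k ≥ 2r apart, every vertex is near at
-- most one member of S, and for x near s its distance to the set S equals its
-- distance to s.  Moreover N^j(S) is exactly the set of vertices at distance j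
-- from S.  Because diam G > k ≥ 2r, every s ∈ S has a vertex at distance ≥ r,
-- hence vertices at every distance ≤ r.  So each s ∈ S owns
--   * three vertices at distances i-1, i, i+1 from it, and
--   * a vertex y at distance i together with its ≥ δ neighbours,
-- all lying in U = N^{i-1}(S) ∪ N^i(S) ∪ N^{i+1}(S) and all near s.  These
-- blocks are pairwise disjoint, so |U| ≥ 3|S| resp. |U| ≥ (δ+1)|S|.

open import Defs hiding (sym)
open import Data.Nat using (ℕ; zero; suc; _+_; _*_; _∸_; _≤_; _<_; z≤n; s≤s; _≤?_)
open import Data.Nat.Properties
  using (≤-trans; ≤-refl; ≤-reflexive; ≤-antisym; ≤-pred; <⇒≤; <-≤-trans; ≮⇒≥; ≰⇒>; <⇒≱; <⇒≢; <-irrefl;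
         <-cmp; n<1+n; n≤1+n; m≤m+n; m<n⇒m<1+n; m<1+n⇒m<n∨m≡n; m≤n⇒m<n∨m≡n;
         +-comm; +-assoc; +-suc; +-identityʳ; +-mono-≤; +-monoʳ-≤; +-mono-<; *-comm; module ≤-Reasoning)
open import Relation.Binary.Definitions using (tri<; tri≈; tri>)
open import Data.Fin using (Fin)
import Data.Fin as Fin
import Data.Fin.Properties as Fin
open import Data.Fin.Subset using (Subset; ∣_∣; _∈_; _∉_; _∪_; _─_; _-_)
open import Data.Fin.Subset.Properties
  using (_∈?_; x∈p⇒∣p-x∣<∣p∣; x∈p∧x≢y⇒x∈p-y; x∈p∪q⁻; x∈p∪q⁺; p─q⊆p; x∈p∧x∉q⇒x∈p─q; ∣p∣≤∣x∷p∣)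
open import Data.Bool using (Bool; true; false; _∧_; T)
open import Data.Bool.Properties using (T-≡; T-∧)
import Data.Bool as Bool
open import Data.List using (List; []; _∷_; _++_; length; allFin; map)
open import Data.List.Properties using (length-++; length-map)
open import Data.List.Relation.Unary.All using (All; []; _∷_)
import Data.List.Relation.Unary.All as All
import Data.List.Relation.Unary.All.Properties as All
open import Data.List.Relation.Unary.Any using (here; there; satisfied)
import Data.List.Relation.Unary.Any as Any
open import Data.List.Relation.Unary.Any.Properties using (any⁺; any⁻)
open import Data.List.Relation.Unary.AllPairs using ([]; _∷_)
open import Data.List.Relation.Unary.Unique.Propositional using (Unique)
import Data.List.Relation.Unary.Unique.Propositional.Properties as Unique
open import Data.List.Membership.Propositional using () renaming (_∈_ to _∈ₗ_)
open import Data.List.Membership.Propositional.Properties using (∈-allFin; ∈-++⁻)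
open import Data.Vec using (tabulate; lookup)
  renaming ([] to []ᵛ; _∷_ to _∷ᵛ_; here to hereᵛ; there to thereᵛ)
open import Data.Vec.Properties using (lookup∘tabulate; []=⇒lookup; lookup⇒[]=)
open import Data.Product using (_×_; ∃-syntax; _,_; proj₁; proj₂)
open import Data.Sum using (_⊎_; inj₁; inj₂; [_,_]′)
open import Data.Empty using (⊥-elim)
open import Function using (_∘_)
open import Function.Bundles using (Equivalence)
open import Relation.Nullary using (¬_; Dec; yes; no)
open import Relation.Nullary.Decidable using (_×-dec_)
open import Relation.Unary using (Decidable)
open import Relation.Binary.PropositionalEquality using (_≡_; _≢_; refl; sym; trans; cong; subst)

-- Counting in finite subsets

unique-length≤ : ∀ {n} (U : Subset n) {xs : List (Fin n)} →
                 Unique xs → All (_∈ U) xs → length xs ≤ ∣ U ∣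
unique-length≤ U {[]} _ _ = z≤n
unique-length≤ U {x ∷ xs} (x∉xs ∷ uniq) (x∈U ∷ xs⊆U) =
  ≤-trans (s≤s (unique-length≤ (U - x) uniq (All.zipWith removed (xs⊆U , x∉xs))))
          (x∈p⇒∣p-x∣<∣p∣ x∈U)
  where
  removed : ∀ {y} → y ∈ U × x ≢ y → y ∈ U - x
  removed (y∈U , x≢y) = x∈p∧x≢y⇒x∈p-y y∈U (x≢y ∘ sym)

enumerate : ∀ {n} (P : Subset n) →
            ∃[ xs ] Unique xs × All (_∈ P) xs × ∣ P ∣ ≡ length xs
enumerate []ᵛ = [] , [] , [] , refl
enumerate (b ∷ᵛ P) with enumerate P
... | xs , uniq , xs⊆P , size with b
...   | true  = Fin.zero ∷ map Fin.suc xs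
              , All.map⁺ (All.universal (λ _ ()) xs) ∷ Unique.map⁺ Fin.suc-injective uniq
              , hereᵛ ∷ All.map⁺ (All.map thereᵛ xs⊆P)
              , cong suc (trans size (sym (length-map Fin.suc xs)))
...   | false = map Fin.suc xs
              , Unique.map⁺ Fin.suc-injective uniq
              , All.map⁺ (All.map thereᵛ xs⊆P)
              , trans size (sym (length-map Fin.suc xs))

∣p∪q∣≤∣p∣+∣q∣ : ∀ {n} (p q : Subset n) → ∣ p ∪ q ∣ ≤ ∣ p ∣ + ∣ q ∣
∣p∪q∣≤∣p∣+∣q∣ []ᵛ           []ᵛ           = z≤n
∣p∪q∣≤∣p∣+∣q∣ (true ∷ᵛ p)   (b ∷ᵛ q)      =
  s≤s (≤-trans (∣p∪q∣≤∣p∣+∣q∣ p q) (+-monoʳ-≤ ∣ p ∣ (∣p∣≤∣x∷p∣ b q)))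
∣p∪q∣≤∣p∣+∣q∣ (false ∷ᵛ p)  (true ∷ᵛ q)   =
  ≤-trans (s≤s (∣p∪q∣≤∣p∣+∣q∣ p q)) (≤-reflexive (sym (+-suc ∣ p ∣ ∣ q ∣)))
∣p∪q∣≤∣p∣+∣q∣ (false ∷ᵛ p)  (false ∷ᵛ q)  = ∣p∪q∣≤∣p∣+∣q∣ p q

-- Double counting with owners: if each s ∈ S owns a block of at least c
-- distinct elements of U, and no element is owned by two members of S, then
-- c·|S| ≤ |U|.
module OwnedBlocks {n : ℕ} (U : Subset n) (Owns : Fin n → Fin n → Set) where

  record Block (c : ℕ) (s : Fin n) : Set where
    field
      elems    : List (Fin n)
      distinct : Unique elems
      inside   : All (_∈ U) elems
      large    : c ≤ length elems
      owned    : All (Owns s) elems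

  module _ {c : ℕ} (S : Subset n)
           (owner-unique : ∀ {s s' x} → s ∈ S → s' ∈ S → Owns s x → Owns s' x → s ≡ s')
           (block : ∀ s → s ∈ S → Block c s) where

    gather : (ss : List (Fin n)) → All (_∈ S) ss → List (Fin n)
    gather []       []          = []
    gather (s ∷ ss) (s∈S ∷ ss⊆S) = Block.elems (block s s∈S) ++ gather ss ss⊆S

    gather-owner : ∀ ss ss⊆S {x} → x ∈ₗ gather ss ss⊆S → ∃[ t ] t ∈ₗ ss × Owns t x
    gather-owner (s ∷ ss) (s∈S ∷ ss⊆S) x∈ with ∈-++⁻ (Block.elems (block s s∈S)) x∈
    ... | inj₁ x∈blk = s , here refl , All.lookup (Block.owned (block s s∈S)) x∈blk
    ... | inj₂ x∈rest with gather-owner ss ss⊆S x∈rest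
    ...   | t , t∈ss , owns = t , there t∈ss , owns

    gather-unique : ∀ ss ss⊆S → Unique ss → Unique (gather ss ss⊆S)
    gather-unique []       []           []              = []
    gather-unique (s ∷ ss) (s∈S ∷ ss⊆S) (s∉ss ∷ uniq) =
      Unique.++⁺ (Block.distinct (block s s∈S)) (gather-unique ss ss⊆S uniq) disjoint
      where
      disjoint : ∀ {x} → ¬ (x ∈ₗ Block.elems (block s s∈S) × x ∈ₗ gather ss ss⊆S)
      disjoint (x∈blk , x∈rest) with gather-owner ss ss⊆S x∈rest
      ... | t , t∈ss , owns =
        All.lookup s∉ss t∈ss
          (owner-unique s∈S (All.lookup ss⊆S t∈ss)
                        (All.lookup (Block.owned (block s s∈S)) x∈blk) owns)

    gather-inside : ∀ ss ss⊆S → All (_∈ U) (gather ss ss⊆S)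
    gather-inside []       []           = []
    gather-inside (s ∷ ss) (s∈S ∷ ss⊆S) =
      All.++⁺ (Block.inside (block s s∈S)) (gather-inside ss ss⊆S)

    gather-length : ∀ ss ss⊆S → length ss * c ≤ length (gather ss ss⊆S)
    gather-length []       []           = z≤n
    gather-length (s ∷ ss) (s∈S ∷ ss⊆S) =
      subst (_ ≤_) (sym (length-++ (Block.elems (block s s∈S))))
            (+-mono-≤ (Block.large (block s s∈S)) (gather-length ss ss⊆S))

    blocks-bound : c * ∣ S ∣ ≤ ∣ U ∣
    blocks-bound with enumerate S
    ... | ss , uniq , ss⊆S , size =
      ≤-trans (≤-reflexive (trans (cong (c *_) size) (*-comm c (length ss))))
        (≤-trans (gather-length ss ss⊆S)
                 (unique-length≤ U (gather-unique ss ss⊆S uniq) (gather-inside ss ss⊆S)))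

-- The least number principle

Least : (ℕ → Set) → ℕ → Set
Least P d = P d × (∀ m → m < d → ¬ P m)

least-unique : ∀ {P : ℕ → Set} {a b} → Least P a → Least P b → a ≡ b
least-unique {a = a} {b} (pa , below-a) (pb , below-b) with <-cmp a b
... | tri< a<b _ _ = ⊥-elim (below-b a a<b pa)
... | tri≈ _ a≡b _ = a≡b
... | tri> _ _ b<a = ⊥-elim (below-a b b<a pb)

module _ {P : ℕ → Set} (P? : Decidable P) where

  search-below : ∀ b → (∃[ d ] d < b × Least P d) ⊎ (∀ m → m < b → ¬ P m)
  search-below zero = inj₂ (λ _ ())
  search-below (suc b) with search-below b
  ... | inj₁ (d , d<b , least) = inj₁ (d , m<n⇒m<1+n d<b , least)
  ... | inj₂ none with P? b
  ...   | yes pb = inj₁ (b , n<1+n b , pb , none)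
  ...   | no ¬pb = inj₂ λ m m<1+b → [ none m , (λ { refl → ¬pb }) ]′ (m<1+n⇒m<n∨m≡n m<1+b)

  least-exists : ∀ {ℓ} → P ℓ → ∃[ d ] d ≤ ℓ × Least P d
  least-exists {ℓ} pℓ with search-below (suc ℓ)
  ... | inj₁ (d , d<1+ℓ , least) = d , ≤-pred d<1+ℓ , least
  ... | inj₂ none                 = ⊥-elim (none ℓ (n<1+n ℓ) pℓ)

-- Walks and geodesics.  Note that IsDist G u v d is Least (Walk G u v) d.

module Walks {n : ℕ} (G : Graph n) where

  adj-sym : ∀ {u v} → Adj G u v → Adj G v u
  adj-sym {u} {v} e = trans (Graph.sym G v u) e

  adj-irrefl : ∀ {u v} → Adj G u v → u ≢ v
  adj-irrefl {u} e refl with () ← trans (sym e) (irrefl G u)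

  _∷ʳ_ : ∀ {u w v ℓ} → Walk G u w ℓ → Adj G w v → Walk G u v (suc ℓ)
  []      ∷ʳ e' = e' ∷ []
  (e ∷ ω) ∷ʳ e' = e ∷ (ω ∷ʳ e')

  _++ʷ_ : ∀ {u w v a b} → Walk G u w a → Walk G w v b → Walk G u v (a + b)
  []      ++ʷ ω' = ω'
  (e ∷ ω) ++ʷ ω' = e ∷ (ω ++ʷ ω')

  reverse : ∀ {u v ℓ} → Walk G u v ℓ → Walk G v u ℓ
  reverse []      = []
  reverse (e ∷ ω) = reverse ω ∷ʳ adj-sym e

  unsnoc : ∀ {u v ℓ} → Walk G u v (suc ℓ) → ∃[ w ] Walk G u w ℓ × Adj G w v
  unsnoc (e ∷ [])      = _ , [] , e
  unsnoc (e ∷ (e' ∷ ω)) with unsnoc (e' ∷ ω)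
  ... | w , ω' , e'' = w , e ∷ ω' , e''

  walk? : ∀ ℓ u v → Dec (Walk G u v ℓ)
  walk? zero u v with u Fin.≟ v
  ... | yes refl = yes []
  ... | no u≢v   = no λ { [] → u≢v refl }
  walk? (suc ℓ) u v with Fin.any? (λ w → (adj G u w Bool.≟ true) ×-dec walk? ℓ w v)
  ... | yes (w , e , ω) = yes (e ∷ ω)
  ... | no none         = no λ { (e ∷ ω) → none (_ , e , ω) }

  geodesic : ∀ {u v ℓ} → Walk G u v ℓ → ∃[ d ] d ≤ ℓ × IsDist G u v d
  geodesic {u} {v} = least-exists (λ m → walk? m u v)

  distance : Connected G → ∀ u v → ∃[ d ] IsDist G u v d
  distance conn u v with geodesic (proj₂ (conn u v))
  ... | d , _ , γ = d , γ

  far-endpoint : Connected G → ∀ {u v d} r → IsDist G u v d → r + r ≤ d →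
                 ∀ s → ∃[ t ] ∃[ L ] IsDist G s t L × r ≤ L
  far-endpoint conn {u} {v} {d} r γ 2r≤d s with distance conn s u | distance conn s v
  ... | d₁ , γ₁ | d₂ , γ₂ with r ≤? d₁ | r ≤? d₂
  ...   | yes r≤d₁ | _        = u , d₁ , γ₁ , r≤d₁
  ...   | no _     | yes r≤d₂ = v , d₂ , γ₂ , r≤d₂
  ...   | no d₁≱r  | no d₂≱r  = ⊥-elim (proj₂ γ (d₁ + d₂) too-short (reverse (proj₁ γ₁) ++ʷ proj₁ γ₂))
    where
    too-short : d₁ + d₂ < d
    too-short = <-≤-trans (+-mono-< (≰⇒> d₁≱r) (≰⇒> d₂≱r)) 2r≤d

  geodesic-prefix : ∀ {u v L a} → IsDist G u v L → a ≤ L → ∃[ w ] IsDist G u w a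
  geodesic-prefix {L = zero}  γ z≤n = _ , γ
  geodesic-prefix {u} {L = suc L} γ a≤1+L with m≤n⇒m<n∨m≡n a≤1+L
  ... | inj₂ refl  = _ , γ
  ... | inj₁ a<1+L = geodesic-prefix (proj₂ (drop-last γ)) (≤-pred a<1+L)
    where
    drop-last : ∀ {v} → IsDist G u v (suc L) → ∃[ w ] IsDist G u w L
    drop-last (ω , shorter) with unsnoc ω
    ... | w , ω' , e = w , ω' , λ m m<L ω'' → shorter (suc m) (s≤s m<L) (ω'' ∷ʳ e)

∈-tabulate⁻ : ∀ {n} (f : Fin n → Bool) {x} → x ∈ tabulate f → f x ≡ true
∈-tabulate⁻ f {x} x∈ = trans (sym (lookup∘tabulate f x)) ([]=⇒lookup x∈)

∈-tabulate⁺ : ∀ {n} (f : Fin n → Bool) {x} → f x ≡ true → x ∈ tabulate f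
∈-tabulate⁺ f {x} fx = lookup⇒[]= x (tabulate f) (trans (lookup∘tabulate f x) fx)

x∈p─q⇒x∉q : ∀ {n} {x : Fin n} (p q : Subset n) → x ∈ p ─ q → x ∉ q
x∈p─q⇒x∉q (_ ∷ᵛ p) (true ∷ᵛ q) ()       hereᵛ
x∈p─q⇒x∉q (_ ∷ᵛ p) (_ ∷ᵛ q)    (thereᵛ x∈) (thereᵛ x∈q) = x∈p─q⇒x∉q p q x∈ x∈q

module Neighbourhood {n : ℕ} (G : Graph n) where

  N⁻ : ∀ {B x} → x ∈ N G B → ∃[ u ] u ∈ B × Adj G u x
  N⁻ {B} {x} x∈N with satisfied (any⁻ _ (allFin n) (Equivalence.from T-≡ (∈-tabulate⁻ _ x∈N)))
  ... | u , holds with Equivalence.to (T-∧ {lookup B u}) holds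
  ...   | u∈B , e = u , lookup⇒[]= u B (Equivalence.to T-≡ u∈B) , Equivalence.to T-≡ e

  N⁺ : ∀ {B u x} → u ∈ B → Adj G u x → x ∈ N G B
  N⁺ {B} {u} {x} u∈B e =
    ∈-tabulate⁺ _ (Equivalence.to T-≡ (any⁺ _ (Any.map (λ { refl → holds }) (∈-allFin u))))
    where
    holds : T (lookup B u ∧ adj G u x)
    holds = Equivalence.from T-∧ (Equivalence.from T-≡ ([]=⇒lookup u∈B) , Equivalence.from T-≡ e)

-- Distance from a vertex set S, and the identification N^j(S) = {x | d(S,x) = j}

module DistanceToSet {n : ℕ} (G : Graph n) (S : Subset n) where
  open Walks G
  open Neighbourhood G

  Reaches : ℕ → Fin n → Set
  Reaches m x = ∃[ s ] s ∈ S × Walk G s x m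

  reaches? : ∀ m x → Dec (Reaches m x)
  reaches? m x = Fin.any? λ s → (s ∈? S) ×-dec walk? m s x

  AtLevel : ℕ → Fin n → Set
  AtLevel j x = Least (λ m → Reaches m x) j

  level-exists : ∀ {m x} → Reaches m x → ∃[ d ] d ≤ m × AtLevel d x
  level-exists {x = x} = least-exists (λ m → reaches? m x)

  level-step : ∀ {j d y x} → AtLevel j y → Adj G y x → AtLevel d x → d ≤ suc j
  level-step {j} ((s , s∈S , ω) , _) e (_ , below) = ≮⇒≥ λ 1+j<d → below (suc j) 1+j<d (s , s∈S , ω ∷ʳ e)

  level-pred : ∀ {j x} → AtLevel (suc j) x → ∃[ u ] AtLevel j u × Adj G u x
  level-pred {j} x-at-1+j@((s , s∈S , ω) , _) with unsnoc ω
  ... | u , ω' , e with level-exists (s , s∈S , ω')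
  ...   | d , d≤j , u-at-d =
    u , subst (λ t → AtLevel t u) (≤-antisym d≤j (≤-pred (level-step u-at-d e x-at-1+j))) u-at-d , e

  level-next : ∀ {j u x} → AtLevel j u → Adj G u x → (∀ d → d ≤ j → ¬ AtLevel d x) → AtLevel (suc j) x
  level-next ((s , s∈S , ω) , _) e not-lower =
    (s , s∈S , ω ∷ʳ e) , λ m m<1+j r → let (d , d≤m , x-at-d) = level-exists r
                                       in not-lower d (≤-trans d≤m (≤-pred m<1+j)) x-at-d

  level-beyond : ∀ {j u x} → AtLevel (suc j) u → Adj G u x →
                 ¬ AtLevel j x → ¬ AtLevel (suc j) x → AtLevel (suc (suc j)) x
  level-beyond {j} {x = x} u-at-1+j e not-j not-1+j = level-next u-at-1+j e not-lower
    where
    not-lower : ∀ d → d ≤ suc j → ¬ AtLevel d x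
    not-lower d d≤1+j x-at-d with m≤n⇒m<n∨m≡n (≤-pred (level-step x-at-d (adj-sym e) u-at-1+j))
    ... | inj₁ j<d = not-1+j (subst (λ t → AtLevel t x) (≤-antisym d≤1+j j<d) x-at-d)
    ... | inj₂ j≡d = not-j (subst (λ t → AtLevel t x) (sym j≡d) x-at-d)

  levels-apart : ∀ {a b x y} → AtLevel a x → AtLevel b y → a ≢ b → x ≢ y
  levels-apart x-at-a y-at-b a≢b refl = a≢b (least-unique x-at-a y-at-b)

  ∈S⇒level0 : ∀ {x} → x ∈ S → AtLevel 0 x
  ∈S⇒level0 {x} x∈S = (x , x∈S , []) , λ _ ()

  level0⇒∈S : ∀ {x} → AtLevel 0 x → x ∈ S
  level0⇒∈S ((s , s∈S , []) , _) = s∈S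

  module Layers (no-edge : ∀ {s s'} → s ∈ S → s' ∈ S → ¬ Adj G s s') where

    Nʲ⇒level : ∀ j {x} → x ∈ Nʲ G j S → AtLevel j x
    level⇒Nʲ : ∀ j {x} → AtLevel j x → x ∈ Nʲ G j S

    Nʲ⇒level zero x∈S = ∈S⇒level0 x∈S
    Nʲ⇒level (suc zero) x∈N =
      let u , u∈S , e = N⁻ x∈N
      in level-next (∈S⇒level0 u∈S) e
           λ { zero z≤n x-at-0 → no-edge u∈S (level0⇒∈S x-at-0) e }
    Nʲ⇒level (suc (suc j)) x∈ =
      let u , u∈ , e = N⁻ (p─q⊆p _ _ x∈)
          fresh = x∈p─q⇒x∉q _ _ x∈ ∘ x∈p∪q⁺
      in level-beyond (Nʲ⇒level (suc j) u∈) e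
           (λ x-at-j   → fresh (inj₁ (level⇒Nʲ j x-at-j)))
           (λ x-at-1+j → fresh (inj₂ (level⇒Nʲ (suc j) x-at-1+j)))

    level⇒Nʲ zero x-at-0 = level0⇒∈S x-at-0
    level⇒Nʲ (suc zero) x-at-1 =
      let u , u-at-0 , e = level-pred x-at-1
      in N⁺ (level0⇒∈S u-at-0) e
    level⇒Nʲ (suc (suc j)) x-at-2+j =
      let u , u-at-1+j , e = level-pred x-at-2+j
          not-j   = λ x∈Nʲ → <-irrefl (least-unique (Nʲ⇒level j x∈Nʲ) x-at-2+j) (m<n⇒m<1+n (n<1+n j))
          not-1+j = λ x∈Nʲ → <-irrefl (least-unique (Nʲ⇒level (suc j) x∈Nʲ) x-at-2+j) (n<1+n (suc j))
      in x∈p∧x∉q⇒x∈p─q (N⁺ (level⇒Nʲ (suc j) u-at-1+j) e) ([ not-j , not-1+j ]′ ∘ x∈p∪q⁻ _ _)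

-- Consequences of k-independence

module Independence {n : ℕ} (G : Graph n) (k : ℕ) (S : Subset n) (indep : KIndependent G k S) where
  open Walks G

  close-members : ∀ {s s' x a b} → s ∈ S → s' ∈ S →
                  Walk G s x a → Walk G s' x b → a + b ≤ k → s ≡ s'
  close-members {s} {s'} s∈S s'∈S ω ω' a+b≤k with s Fin.≟ s'
  ... | yes s≡s' = s≡s'
  ... | no s≢s' with geodesic (ω ++ʷ reverse ω')
  ...   | d , d≤a+b , γ = ⊥-elim (<⇒≱ (indep s s' s∈S s'∈S s≢s' d γ) (≤-trans d≤a+b a+b≤k))

  no-edge : 1 ≤ k → ∀ {s s'} → s ∈ S → s' ∈ S → ¬ Adj G s s'
  no-edge 1≤k s∈S s'∈S e = adj-irrefl e (close-members s∈S s'∈S (e ∷ []) [] 1≤k)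

-- The blocks.  Throughout, r = p + 2 is the radius, with 2r ≤ k.

module Construction {n : ℕ} (G : Graph n) (k : ℕ) (S : Subset n) (indep : KIndependent G k S)
                    (conn : Connected G) (diam : DiamAtLeast G (k + 1))
                    (p : ℕ) (room : suc (suc p) + suc (suc p) ≤ k) where
  open Walks G
  open Independence G k S indep
  open DistanceToSet G S
  open Layers (no-edge (≤-trans (s≤s z≤n) room))

  r : ℕ
  r = suc (suc p)

  p<r : p < r
  p<r = m<n⇒m<1+n (n<1+n p)

  p≤r : p ≤ r
  p≤r = <⇒≤ p<r

  Near : Fin n → Fin n → Set
  Near s x = ∃[ ℓ ] ℓ ≤ r × Walk G s x ℓ

  near-unique : ∀ {s s' x} → s ∈ S → s' ∈ S → Near s x → Near s' x → s ≡ s'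
  near-unique s∈S s'∈S (a , a≤r , ω) (b , b≤r , ω') =
    close-members s∈S s'∈S ω ω' (≤-trans (+-mono-≤ a≤r b≤r) room)

  owned-level : ∀ {s x ℓ} → s ∈ S → IsDist G s x ℓ → ℓ ≤ r → AtLevel ℓ x
  owned-level {s} {x} {ℓ} s∈S (ω , shorter) ℓ≤r = (s , s∈S , ω) , closer-member-is-s
    where
    closer-member-is-s : ∀ m → m < ℓ → ¬ Reaches m x
    closer-member-is-s m m<ℓ (s' , s'∈S , ω') =
      shorter m m<ℓ (subst (λ t → Walk G t x m)
                           (near-unique s'∈S s∈S (m , ≤-trans (<⇒≤ m<ℓ) ℓ≤r , ω') (_ , ℓ≤r , ω)) ω')

  -- since diam G > k ≥ 2r, around every s ∈ S there is a vertex at each level a ≤ r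
  layer : ∀ {s} → s ∈ S → ∀ a → a ≤ r → ∃[ x ] AtLevel a x × Walk G s x a
  layer {s} s∈S a a≤r =
    let u , v , d , γᵤᵥ , k+1≤d = diam
        t , L , γ , r≤L = far-endpoint conn r γᵤᵥ (≤-trans room (≤-trans (m≤m+n k 1) k+1≤d)) s
        x , γₓ = geodesic-prefix γ (≤-trans a≤r r≤L)
    in x , owned-level s∈S γₓ a≤r , proj₁ γₓ

  U : Subset n
  U = Nʲ G p S ∪ (Nʲ G (suc p) S ∪ Nʲ G r S)

  ∣U∣≤ : ∣ U ∣ ≤ ∣ Nʲ G p S ∣ + ∣ Nʲ G (suc p) S ∣ + ∣ Nʲ G r S ∣
  ∣U∣≤ = begin
    ∣ U ∣                                                   ≤⟨ ∣p∪q∣≤∣p∣+∣q∣ (Nʲ G p S) _ ⟩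
    ∣ Nʲ G p S ∣ + ∣ Nʲ G (suc p) S ∪ Nʲ G r S ∣            ≤⟨ +-monoʳ-≤ ∣ Nʲ G p S ∣ (∣p∪q∣≤∣p∣+∣q∣ (Nʲ G (suc p) S) _) ⟩
    ∣ Nʲ G p S ∣ + (∣ Nʲ G (suc p) S ∣ + ∣ Nʲ G r S ∣)     ≡⟨ sym (+-assoc ∣ Nʲ G p S ∣ _ _) ⟩
    ∣ Nʲ G p S ∣ + ∣ Nʲ G (suc p) S ∣ + ∣ Nʲ G r S ∣       ∎
    where open ≤-Reasoning

  level-in-U : ∀ {d x} → p ≤ d → d ≤ r → AtLevel d x → x ∈ U
  level-in-U {d} {x} p≤d d≤r x-at-d with m≤n⇒m<n∨m≡n p≤d
  ... | inj₂ refl = x∈p∪q⁺ (inj₁ (level⇒Nʲ p x-at-d))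
  ... | inj₁ p<d with m≤n⇒m<n∨m≡n p<d
  ...   | inj₂ refl = x∈p∪q⁺ (inj₂ (x∈p∪q⁺ (inj₁ (level⇒Nʲ (suc p) x-at-d))))
  ...   | inj₁ 1+p<d = x∈p∪q⁺ (inj₂ (x∈p∪q⁺ (inj₂
                         (level⇒Nʲ r (subst (λ t → AtLevel t x) (≤-antisym d≤r 1+p<d) x-at-d)))))

  neighbour-in-U : ∀ {s y w} → s ∈ S → AtLevel (suc p) y → Walk G s y (suc p) → Adj G y w → w ∈ U
  neighbour-in-U s∈S y-at ω e =
    let d , d≤r , w-at = level-exists (_ , s∈S , ω ∷ʳ e)
    in level-in-U (≤-pred (level-step w-at (adj-sym e) y-at)) d≤r w-at

  open OwnedBlocks U Near public

  three-layers : ∀ {s} → s ∈ S → Block 3 s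
  three-layers s∈S with layer s∈S p p≤r | layer s∈S (suc p) (n≤1+n _) | layer s∈S r ≤-refl
  ... | x₀ , l₀ , ω₀ | x₁ , l₁ , ω₁ | x₂ , l₂ , ω₂ = record
    { elems    = x₀ ∷ x₁ ∷ x₂ ∷ []
    ; distinct = (levels-apart l₀ l₁ (<⇒≢ (n<1+n p)) ∷ levels-apart l₀ l₂ (<⇒≢ p<r) ∷ [])
               ∷ (levels-apart l₁ l₂ (<⇒≢ (n<1+n (suc p))) ∷ []) ∷ [] ∷ []
    ; inside   = level-in-U ≤-refl p≤r l₀ ∷ level-in-U (n≤1+n p) (n≤1+n _) l₁ ∷ level-in-U p≤r ≤-refl l₂ ∷ []
    ; large    = ≤-refl
    ; owned    = (p , p≤r , ω₀) ∷ (suc p , n≤1+n _ , ω₁) ∷ (r , ≤-refl , ω₂) ∷ []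
    }

  star : ∀ δ → (∀ v → δ ≤ degree G v) → ∀ {s} → s ∈ S → Block (δ + 1) s
  star δ min-deg s∈S with layer s∈S (suc p) (n≤1+n _)
  ... | y , y-at , ω with enumerate (tabulate (adj G y))
  ...   | nbrs , uniq , nbrs-adj , size = record
    { elems    = y ∷ nbrs
    ; distinct = All.map (adj-irrefl ∘ ∈-tabulate⁻ _) nbrs-adj ∷ uniq
    ; inside   = level-in-U (n≤1+n p) (n≤1+n _) y-at ∷ All.map (neighbour-in-U s∈S y-at ω ∘ ∈-tabulate⁻ _) nbrs-adj
    ; large    = ≤-trans (≤-reflexive (+-comm δ 1)) (s≤s (≤-trans (min-deg y) (≤-reflexive size)))
    ; owned    = (suc p , n≤1+n _ , ω) ∷ All.map (λ w∈ → r , ≤-refl , ω ∷ʳ ∈-tabulate⁻ _ w∈) nbrs-adj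
    }

-- Write i = p + 1 (the case i = 0 is excluded by 3 ≤ i); after rewriting
-- i + 1 as p + 2, both bounds are blocks-bound for the two kinds of blocks, combined
-- with subadditivity of |U|.

lemma1 : (k n δ : ℕ) → 1 ≤ k → (G : Graph n) → Connected G → IsMinDegree G δ → DiamAtLeast G (k + 1) → (S : Subset n) → KIndependent G k S → (i : ℕ) → 3 ≤ i → 2 * (i + 1) ≤ k →
    (3 * ∣ S ∣ ≤ ∣ Nʲ G (i ∸ 1) S ∣ + ∣ Nʲ G i S ∣ + ∣ Nʲ G (i + 1) S ∣)
    × (2 ≤ δ → (δ + 1) * ∣ S ∣ ≤ ∣ Nʲ G (i ∸ 1) S ∣ + ∣ Nʲ G i S ∣ + ∣ Nʲ G (i + 1) S ∣)
lemma1 k n δ _ G conn _ diam S indep zero () _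
lemma1 k n δ _ G conn (min-deg , _) diam S indep (suc p) _ room rewrite +-comm p 1 =
    ≤-trans (blocks-bound S near-unique (λ _ → three-layers)) ∣U∣≤
  , λ _ → ≤-trans (blocks-bound S near-unique (λ _ → star δ min-deg)) ∣U∣≤
  where
  open Construction G k S indep conn diam p (subst (_≤ k) (cong (suc (suc p) +_) (+-identityʳ _)) room)
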